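{- Let $\ell, m, n$ be integers with $\ell \geq 2$, $m \geq 3$, $n \geq 4$ and $m < 4n$. Then \[ F_\ell = [F_m^{ -1} \bmod F_n] \] if and only if one of the following holds: (c1) $\ell = n - \tfrac12\big(3 + (-1)^n\big)$ and $m = n-2$; or (c2) $\ell = n - \tfrac12\big(3 - (-1)^n\big)$ and $m \in \{n-1, n+1, n+2\}$; or (c3) $\ell = 2$, $m = 2n-2$, and $n$ is odd; or (c4) $\ell = 2$, $m \in \{2n-1, 2n+1, 2n+2\}$, and $n$ is even; or (c5) $\ell = n-2$ and $m = 3n-2$; or (c6) $\ell = n-1$ and $m \in \{3n-1, 3n+1, 3n+2\}$; or (c7) $\ell = 2$ and $m = 4n-1$.
   Context: $(F_n)_{n\ge1}$ is the Fibonacci sequence: $F_1 = F_2 = 1$ and $F_n = F_{n-1} + F_{n-2}$ for $n \geq 3$. For integers $a$ and $b \geq 1$ with $\gcd(a,b)=1$, $[a^{ -1} \bmod b]$ denotes the unique $x \in \{0,1,\dots,b-1\}$ with $ax \equiv 1 \pmod b$; if $\gcd(a,b) > 1$, one sets $[a^{ -1} \bmod b] := \infty$ (so in that case it is not equal to any Fibonacci number). -}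

module Defs where

open import Data.Nat using (ℕ; zero; suc; _+_; _*_; _∸_; _<_; _%_; NonZero)
open import Data.Nat.GCD using (gcd)
open import Data.Product using (_×_)
open import Relation.Binary.PropositionalEquality using (_≡_)

fib : ℕ → ℕ
fib zero = zero
fib (suc zero) = suc zero
fib (suc (suc n)) = fib (suc n) + fib n

-- "[a⁻¹ mod b] = x"  (for b ≥ 1): gcd a b = 1, x ∈ {0,…,b-1} and a*x ≡ 1 (mod b).
-- If gcd a b > 1 the inverse is ∞, equal to no natural number, so the predicate fails.
InvModIs : (a b : ℕ) → .{{NonZero b}} → ℕ → Set
InvModIs a b x = (gcd a b ≡ 1) × (x < b) × ((a * x) % b ≡ 1 % b)

{-# OPTIONS --safe #-}
-- Write N = F n, u = F (n - 1) and ε = (-1)ⁿ.  Modulo N one has F (n + k) ≡ u F k, Cassini's identity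
-- gives u² ≡ ε (so u is a unit with inverse εu), and d'Ocagne's identity gives the reflection
-- (-1)ᵃ F (n - 1 - a) ≡ u F (a + 1).  Writing m = q n + r with q < 4, the condition F m F ℓ ≡ 1 becomes
-- F r F ℓ ≡ (εu)^q ∈ {1, εu, ε, u}.  If r + ℓ ≤ n the product F r F ℓ is smaller than N, so it equals one
-- of the residues 1, N - 1, u, N - u = F (n - 2); otherwise reflecting both indices gives an equation of
-- the same kind with index sum below n.  Such residues factor as products of two Fibonacci numbers in
-- only a few ways, because for a, b ≥ 3 the product F a F b lies strictly between F (a + b - 2) and
-- F (a + b - 1) and so is never a Fibonacci number.
module Submission where

open import Defs
open import Data.Nat.Base using (ℕ)
open import Data.Integer.Base using (ℤ)

module FibonacciNat where

  open import Data.Nat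
  open import Data.Nat.Properties
  open import Data.Product using (_×_; _,_)
  open import Data.Sum using (_⊎_; inj₁; inj₂)
  open import Data.Empty using (⊥-elim)
  open import Relation.Nullary using (yes; no)
  open import Relation.Binary.Definitions using (tri<; tri≈; tri>)
  open import Function.Bundles using (_⇔_; mk⇔)
  open import Relation.Binary.PropositionalEquality
  open import Data.Nat.Tactic.RingSolver using (solve-∀)

  fib-+ : ∀ a b → fib (suc (a + b)) ≡ fib (suc a) * fib (suc b) + fib a * fib b
  fib-+ zero b = sym (trans (+-identityʳ _) (+-identityʳ _))
  fib-+ (suc a) b = begin
      fib (suc (suc a + b))
    ≡⟨ cong (λ k → fib (suc k)) (sym (+-suc a b)) ⟩
      fib (suc (a + suc b))
    ≡⟨ fib-+ a (suc b) ⟩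
      fib (suc a) * (fib (suc b) + fib b) + fib a * fib (suc b)
    ≡⟨ regroup (fib (suc a)) (fib a) (fib (suc b)) (fib b) ⟩
      (fib (suc a) + fib a) * fib (suc b) + fib (suc a) * fib b
    ∎
    where
    open ≡-Reasoning
    regroup : ∀ a a′ b b′ → a * (b + b′) + a′ * b ≡ (a + a′) * b + a * b′
    regroup = solve-∀

  fib-suc-pos : ∀ k → 0 < fib (suc k)
  fib-suc-pos zero = s≤s z≤n
  fib-suc-pos (suc k) = ≤-trans (fib-suc-pos k) (m≤m+n _ _)

  fib-≤-suc : ∀ k → fib k ≤ fib (suc k)
  fib-≤-suc zero = z≤n
  fib-≤-suc (suc k) = m≤m+n (fib (suc k)) (fib k)

  fib-<-suc : ∀ k → fib (2 + k) < fib (3 + k)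
  fib-<-suc k = m<m+n (fib (2 + k)) (fib-suc-pos k)

  fib-mono-≤ : ∀ {a b} → a ≤ b → fib a ≤ fib b
  fib-mono-≤ a≤b = go (≤⇒≤′ a≤b)
    where
    go : ∀ {a b} → a ≤′ b → fib a ≤ fib b
    go ≤′-refl = ≤-refl
    go {b = suc b} (≤′-step a≤′b) = ≤-trans (go a≤′b) (fib-≤-suc b)

  fib-mono-< : ∀ {a b} → 2 ≤ a → a < b → fib a < fib b
  fib-mono-< {suc (suc a)} (s≤s (s≤s z≤n)) a<b = <-≤-trans (fib-<-suc a) (fib-mono-≤ a<b)

  fib-mono-<-⇔ : ∀ {a b} → 2 ≤ a → fib a < fib b ⇔ a < b
  fib-mono-<-⇔ 2≤a = mk⇔ (λ fa<fb → ≰⇒> (λ b≤a → <⇒≱ fa<fb (fib-mono-≤ b≤a))) (fib-mono-< 2≤a)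

  2≤fib : ∀ {k} → 3 ≤ k → 2 ≤ fib k
  2≤fib 3≤k = fib-mono-≤ 3≤k

  fib-injective : ∀ {j k} → 3 ≤ k → fib j ≡ fib k → j ≡ k
  fib-injective {j} {k} 3≤k eq with <-cmp j k
  ... | tri≈ _ j≡k _ = j≡k
  ... | tri> _ _ k<j = ⊥-elim (<-irrefl (sym eq) (fib-mono-< (≤-trans (n≤1+n 2) 3≤k) k<j))
  ... | tri< j<k _ _ with j
  ...   | 0 = ⊥-elim (<-irrefl eq (≤-trans (s≤s z≤n) (2≤fib 3≤k)))
  ...   | 1 = ⊥-elim (<-irrefl eq (2≤fib 3≤k))
  ...   | suc (suc _) = ⊥-elim (<-irrefl eq (fib-mono-< (s≤s (s≤s z≤n)) j<k))

  fib≡1⇒ : ∀ {k} → fib k ≡ 1 → k ≡ 1 ⊎ k ≡ 2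
  fib≡1⇒ {1} _ = inj₁ refl
  fib≡1⇒ {2} _ = inj₂ refl
  fib≡1⇒ {suc (suc (suc k))} eq = ⊥-elim (<-irrefl (sym eq) (2≤fib {3 + k} (s≤s (s≤s (s≤s z≤n)))))

  fib≡fib[2+k]⇒ : ∀ k {y} → fib y ≡ fib (2 + k) → y ≡ 2 + k ⊎ (k ≡ 0 × y ≡ 1)
  fib≡fib[2+k]⇒ zero eq with fib≡1⇒ eq
  ... | inj₁ y≡1 = inj₂ (refl , y≡1)
  ... | inj₂ y≡2 = inj₁ y≡2
  fib≡fib[2+k]⇒ (suc k) eq = inj₁ (fib-injective (s≤s (s≤s (s≤s z≤n))) eq)

  fib*fib≤fib : ∀ a b → fib a * fib b ≤ fib (a + b ∸ 1)
  fib*fib≤fib zero b = z≤n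
  fib*fib≤fib (suc a) zero rewrite *-zeroʳ (fib (suc a)) = z≤n
  fib*fib≤fib (suc a) (suc b) rewrite +-suc a b | fib-+ a b = m≤m+n _ _

  fib*fib<fib : ∀ a b {n} → a + b ≤ n → 3 ≤ n → fib a * fib b < fib n
  fib*fib<fib a b {suc (suc (suc n))} a+b≤n (s≤s (s≤s (s≤s z≤n))) =
    ≤-<-trans (fib*fib≤fib a b) (≤-<-trans (fib-mono-≤ (∸-monoˡ-≤ 1 a+b≤n)) (fib-<-suc n))

  fib*fib-between : ∀ a b →
    fib (4 + (a + b)) < fib (3 + a) * fib (3 + b) × fib (3 + a) * fib (3 + b) < fib (5 + (a + b))
  fib*fib-between a b = lower , upper
    where
    open ≤-Reasoning
    lower : fib (4 + (a + b)) < fib (3 + a) * fib (3 + b)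
    lower = begin-strict
        fib (4 + (a + b))
      ≡⟨ cong (λ k → fib (3 + k)) (sym (+-suc a b)) ⟩
        fib (suc ((2 + a) + (1 + b)))
      ≡⟨ fib-+ (2 + a) (1 + b) ⟩
        fib (3 + a) * fib (2 + b) + fib (2 + a) * fib (1 + b)
      <⟨ +-monoʳ-< (fib (3 + a) * fib (2 + b)) (*-monoˡ-< (fib (1 + b)) {{>-nonZero (fib-suc-pos b)}} (fib-<-suc a)) ⟩
        fib (3 + a) * fib (2 + b) + fib (3 + a) * fib (1 + b)
      ≡⟨ sym (*-distribˡ-+ (fib (3 + a)) (fib (2 + b)) (fib (1 + b))) ⟩
        fib (3 + a) * fib (3 + b)
      ∎
    upper : fib (3 + a) * fib (3 + b) < fib (5 + (a + b))
    upper = begin-strict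
        fib (3 + a) * fib (3 + b)
      <⟨ m<m+n _ (*-mono-< (fib-suc-pos (suc a)) (fib-suc-pos (suc b))) ⟩
        fib (3 + a) * fib (3 + b) + fib (2 + a) * fib (2 + b)
      ≡⟨ sym (fib-+ (2 + a) (2 + b)) ⟩
        fib (suc ((2 + a) + (2 + b)))
      ≡⟨ cong (λ k → fib (3 + k)) (trans (+-suc a (suc b)) (cong suc (+-suc a b))) ⟩
        fib (5 + (a + b))
      ∎

  fib*fib≢fib : ∀ a b k → fib (3 + a) * fib (3 + b) ≢ fib k
  fib*fib≢fib a b k eq with k ≤? 4 + (a + b) | fib*fib-between a b
  ... | yes k≤ | lower , _ = <-irrefl (sym eq) (≤-<-trans (fib-mono-≤ k≤) lower)
  ... | no k≰ | _ , upper = <-irrefl eq (<-≤-trans upper (fib-mono-≤ (≰⇒> k≰)))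

  fib*fib≡fib : ∀ {x y k} → 2 ≤ k → fib x * fib y ≡ fib k →
    ((x ≡ 1 ⊎ x ≡ 2) × fib y ≡ fib k) ⊎ ((y ≡ 1 ⊎ y ≡ 2) × fib x ≡ fib k)
  fib*fib≡fib {0} {k = suc k} _ eq = ⊥-elim (<-irrefl eq (fib-suc-pos k))
  fib*fib≡fib {1} _ eq = inj₁ (inj₁ refl , trans (sym (+-identityʳ _)) eq)
  fib*fib≡fib {2} _ eq = inj₁ (inj₂ refl , trans (sym (+-identityʳ _)) eq)
  fib*fib≡fib {suc (suc (suc a))} {0} {suc k} _ eq =
    ⊥-elim (<-irrefl (trans (sym (*-zeroʳ (fib (3 + a)))) eq) (fib-suc-pos k))
  fib*fib≡fib {suc (suc (suc a))} {1} _ eq = inj₂ (inj₁ refl , trans (sym (*-identityʳ _)) eq)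
  fib*fib≡fib {suc (suc (suc a))} {2} _ eq = inj₂ (inj₂ refl , trans (sym (*-identityʳ _)) eq)
  fib*fib≡fib {suc (suc (suc a))} {suc (suc (suc b))} {k} _ eq = ⊥-elim (fib*fib≢fib a b k eq)

  fib*fib≡1 : ∀ x y → fib x * fib y ≡ 1 → (x ≡ 1 ⊎ x ≡ 2) × (y ≡ 1 ⊎ y ≡ 2)
  fib*fib≡1 x y eq = fib≡1⇒ (m*n≡1⇒m≡1 (fib x) (fib y) eq) , fib≡1⇒ (m*n≡1⇒n≡1 (fib x) (fib y) eq)

  fib*fib≡fib∸1 : ∀ {x y} p → x + y ≤ 4 + p → suc (fib x * fib y) ≡ fib (4 + p) → p ≡ 0 × x + y ≡ 4 + p
  fib*fib≡fib∸1 {x} {y} p x+y≤n eq with m≤n⇒m<n∨m≡n x+y≤n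
  ... | inj₁ x+y<n = ⊥-elim (<-irrefl refl (begin-strict
        fib (4 + p)
      ≡⟨ sym eq ⟩
        suc (fib x * fib y)
      ≤⟨ s≤s (≤-trans (fib*fib≤fib x y) (fib-mono-≤ (∸-monoˡ-≤ 1 (s≤s⁻¹ x+y<n)))) ⟩
        1 + fib (2 + p)
      <⟨ +-monoˡ-< (fib (2 + p)) (2≤fib {3 + p} (s≤s (s≤s (s≤s z≤n)))) ⟩
        fib (4 + p)
      ∎))
    where open ≤-Reasoning
  ... | inj₂ x+y≡n = p≡0 p fib[2+p]≤1 , x+y≡n
    where
    open ≤-Reasoning
    fib[2+p]≤1 : fib (2 + p) ≤ 1
    fib[2+p]≤1 = +-cancelˡ-≤ (fib (3 + p)) _ _ (begin
        fib (3 + p) + fib (2 + p)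
      ≡⟨ sym eq ⟩
        suc (fib x * fib y)
      ≤⟨ s≤s (subst (λ k → fib x * fib y ≤ fib (k ∸ 1)) x+y≡n (fib*fib≤fib x y)) ⟩
        suc (fib (3 + p))
      ≡⟨ +-comm 1 _ ⟩
        fib (3 + p) + 1
      ∎)
    p≡0 : ∀ p → fib (2 + p) ≤ 1 → p ≡ 0
    p≡0 zero _ = refl
    p≡0 (suc p) fib[3+p]≤1 = ⊥-elim (<-irrefl refl (≤-trans (2≤fib {3 + p} (s≤s (s≤s (s≤s z≤n)))) fib[3+p]≤1))

module Congruence (N : ℤ) where

  open import Data.Integer hiding (suc)
  open import Function.Bundles using (_⇔_; mk⇔)
  open import Relation.Binary.Bundles using (Setoid)
  open import Relation.Binary.Structures using (IsEquivalence)
  import Relation.Binary.Reasoning.Setoid as SetoidReasoning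
  open import Relation.Binary.PropositionalEquality
  open import Data.Integer.Tactic.RingSolver using (solve-∀)

  infix 4 _≈_
  infixr 4 _,_
  record _≈_ (a b : ℤ) : Set where
    constructor _,_
    field
      quotient : ℤ
      equation : a ≡ b + quotient * N

  ≈-reflexive : ∀ {a b} → a ≡ b → a ≈ b
  ≈-reflexive {a} refl = 0ℤ , add-zero a N
    where
    add-zero : ∀ a N → a ≡ a + 0ℤ * N
    add-zero = solve-∀

  ≈-refl : ∀ {a} → a ≈ a
  ≈-refl = ≈-reflexive refl

  -- not defined by matching on the equation, so that the quotient of ≈-sym (k , e) computes to - k
  ≈-sym : ∀ {a b} → a ≈ b → b ≈ a
  ≈-sym {b = b} (k , a≡b+kN) = - k , trans (cancel b k N) (cong (λ t → t + - k * N) (sym a≡b+kN))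
    where
    cancel : ∀ b k N → b ≡ b + k * N + (- k) * N
    cancel = solve-∀

  ≈-trans : ∀ {a b c} → a ≈ b → b ≈ c → a ≈ c
  ≈-trans {c = c} (k , refl) (j , refl) = j + k , collect c j k N
    where
    collect : ∀ c j k N → c + j * N + k * N ≡ c + (j + k) * N
    collect = solve-∀

  ≈-isEquivalence : IsEquivalence _≈_
  ≈-isEquivalence = record { refl = ≈-refl ; sym = ≈-sym ; trans = ≈-trans }

  ≈-setoid : Setoid _ _
  ≈-setoid = record { isEquivalence = ≈-isEquivalence }

  *-cong : ∀ {a b c d} → a ≈ b → c ≈ d → a * c ≈ b * d
  *-cong {b = b} {d = d} (k , refl) (j , refl) = k * d + b * j + k * j * N , expand b d k j N
    where
    expand : ∀ b d k j N → (b + k * N) * (d + j * N) ≡ b * d + (k * d + b * j + k * j * N) * N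
    expand = solve-∀

  *-congˡ : ∀ a {c d} → c ≈ d → a * c ≈ a * d
  *-congˡ a = *-cong (≈-refl {a})

  *-congʳ : ∀ c {a b} → a ≈ b → a * c ≈ b * c
  *-congʳ c a≈b = *-cong a≈b (≈-refl {c})

  module ≈-Reasoning = SetoidReasoning ≈-setoid

  ≈-respʳ-⇔ : ∀ {a b b′} → b ≈ b′ → a ≈ b ⇔ a ≈ b′
  ≈-respʳ-⇔ b≈b′ = mk⇔ (λ a≈b → ≈-trans a≈b b≈b′) (λ a≈b′ → ≈-trans a≈b′ (≈-sym b≈b′))

module NaturalModulus (M : ℕ) where

  open import Data.Nat.Base as ℕ using (_<_; _≤_; suc; NonZero)
  import Data.Nat.Properties as ℕ
  open import Data.Nat.DivMod using (_%_; _/_; m≡m%n+[m/n]*n; m<n⇒m%n≡m; [m+kn]%n≡m%n)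
  open import Data.Nat.Divisibility using (_∣_; ∣1⇒≡1; ∣m+n∣m⇒∣n; ∣-trans; m∣m*n; n∣m*n)
  open import Data.Nat.GCD using (gcd; gcd[m,n]∣m; gcd[m,n]∣n)
  open import Data.Integer using (+_; +0; +[1+_]; -[1+_]; _+_; _*_; 1ℤ)
  open import Data.Integer.Properties using (+-injective; pos-+; pos-*; +-identityʳ)
  open import Data.Product using (_×_; _,_)
  open import Data.Empty using (⊥-elim)
  open import Function.Bundles using (_⇔_; mk⇔)
  open import Relation.Binary.PropositionalEquality

  open Congruence (+ M) public

  pos-+-* : ∀ b k → + b + + k * + M ≡ + (b ℕ.+ k ℕ.* M)
  pos-+-* b k = sym (trans (pos-+ b (k ℕ.* M)) (cong (λ i → + b + i) (pos-* k M)))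

  +a≢+b+[1+j]*M : ∀ {a} b j → a < M → + a ≢ + b + +[1+ j ] * + M
  +a≢+b+[1+j]*M {a} b j a<M eq = ℕ.<-irrefl refl (ℕ.<-≤-trans a<M M≤a)
    where
    M≤a : M ≤ a
    M≤a = subst (M ≤_) (sym (+-injective (trans eq (pos-+-* b (suc j)))))
            (ℕ.≤-trans (ℕ.m≤m+n M (j ℕ.* M)) (ℕ.m≤n+m _ b))

  ≈⇒≡ : ∀ {a b} → a < M → b < M → + a ≈ + b → a ≡ b
  ≈⇒≡ {b = b} _ _ (+0 , eq) = +-injective (trans eq (+-identityʳ (+ b)))
  ≈⇒≡ {b = b} a<M _ (+[1+ j ] , eq) = ⊥-elim (+a≢+b+[1+j]*M b j a<M eq)
  ≈⇒≡ {a} _ b<M (-[1+ j ] , eq) = ⊥-elim (+a≢+b+[1+j]*M a j b<M (_≈_.equation (≈-sym (-[1+ j ] , eq))))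

  InvModIs⇔ : ∀ a x .{{_ : NonZero M}} → 1 < M → InvModIs a M x ⇔ (x < M × + a * + x ≈ 1ℤ)
  InvModIs⇔ a x 1<M = mk⇔ to from
    where
    to : InvModIs a M x → x < M × + a * + x ≈ 1ℤ
    to (_ , x<M , ax%M≡1%M) = x<M , (+ q , (begin
        + a * + x                 ≡⟨ sym (pos-* a x) ⟩
        + (a ℕ.* x)               ≡⟨ cong +_ (m≡m%n+[m/n]*n (a ℕ.* x) M) ⟩
        + (a ℕ.* x % M ℕ.+ q ℕ.* M) ≡⟨ cong (λ r → + (r ℕ.+ q ℕ.* M)) (trans ax%M≡1%M (m<n⇒m%n≡m 1<M)) ⟩
        + (1 ℕ.+ q ℕ.* M)         ≡⟨ sym (pos-+-* 1 q) ⟩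
        1ℤ + + q * + M            ∎))
      where
      open ≡-Reasoning
      q : ℕ
      q = a ℕ.* x / M
    from : x < M × + a * + x ≈ 1ℤ → InvModIs a M x
    from (x<M , -[1+ j ] , eq) =
      ⊥-elim (+a≢+b+[1+j]*M (a ℕ.* x) j 1<M (_≈_.equation (≈-sym (-[1+ j ] , trans (pos-* a x) eq))))
    from (x<M , + j , eq) = gcd≡1 , x<M , trans (cong (_% M) ax≡1+jM) ([m+kn]%n≡m%n 1 j M)
      where
      ax≡1+jM : a ℕ.* x ≡ 1 ℕ.+ j ℕ.* M
      ax≡1+jM = +-injective (trans (pos-* a x) (trans eq (pos-+-* 1 j)))
      gcd≡1 : gcd a M ≡ 1
      gcd≡1 = ∣1⇒≡1 (∣m+n∣m⇒∣n gcd∣jM+1 (∣-trans (gcd[m,n]∣n a M) (n∣m*n j)))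
        where
        gcd∣jM+1 : gcd a M ∣ j ℕ.* M ℕ.+ 1
        gcd∣jM+1 = subst (gcd a M ∣_) (trans ax≡1+jM (ℕ.+-comm 1 (j ℕ.* M))) (∣-trans (gcd[m,n]∣m a M) (m∣m*n x))

module Signs where

  open import Data.Nat.Base as ℕ using (zero; suc)
  open import Data.Nat.DivMod using (_%_)
  open import Data.Integer using (_*_; _^_; 1ℤ; -1ℤ)
  open import Data.Integer.Properties using (neg-injective; -1*i≡-i)
  open import Data.Product using (_×_; _,_)
  open import Data.Sum using (_⊎_; inj₁; inj₂)
  open import Relation.Binary.PropositionalEquality
  open import Data.Integer.Tactic.RingSolver using (solve-∀)

  ±1 : ℤ → Set
  ±1 s = s ≡ 1ℤ ⊎ s ≡ -1ℤ

  ±1-* : ∀ {s t} → ±1 s → ±1 t → ±1 (s * t)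
  ±1-* (inj₁ refl) (inj₁ refl) = inj₁ refl
  ±1-* (inj₁ refl) (inj₂ refl) = inj₂ refl
  ±1-* (inj₂ refl) (inj₁ refl) = inj₂ refl
  ±1-* (inj₂ refl) (inj₂ refl) = inj₁ refl

  1≢-1 : 1ℤ ≢ -1ℤ
  1≢-1 ()

  -1*s≡1⇒s≡-1 : ∀ {s} → -1ℤ * s ≡ 1ℤ → s ≡ -1ℤ
  -1*s≡1⇒s≡-1 {s} -s≡1 = neg-injective (trans (sym (-1*i≡-i s)) -s≡1)

  double-negation : ∀ s → -1ℤ * (-1ℤ * s) ≡ s
  double-negation = solve-∀

  -1^-parity : ∀ k → (-1ℤ ^ k ≡ 1ℤ × k % 2 ≡ 0) ⊎ (-1ℤ ^ k ≡ -1ℤ × k % 2 ≡ 1)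
  -1^-parity 0 = inj₁ (refl , refl)
  -1^-parity 1 = inj₂ (refl , refl)
  -1^-parity (suc (suc k)) with -1^-parity k
  ... | inj₁ (sign≡1 , even) = inj₁ (trans (double-negation (-1ℤ ^ k)) sign≡1 , even)
  ... | inj₂ (sign≡-1 , odd) = inj₂ (trans (double-negation (-1ℤ ^ k)) sign≡-1 , odd)

  -1^-±1 : ∀ k → ±1 (-1ℤ ^ k)
  -1^-±1 k with -1^-parity k
  ... | inj₁ (sign≡1 , _) = inj₁ sign≡1
  ... | inj₂ (sign≡-1 , _) = inj₂ sign≡-1

  -1^-square : ∀ k → -1ℤ ^ k * -1ℤ ^ k ≡ 1ℤ
  -1^-square zero = refl
  -1^-square (suc k) = trans (square-neg (-1ℤ ^ k)) (-1^-square k)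
    where
    square-neg : ∀ s → -1ℤ * s * (-1ℤ * s) ≡ s * s
    square-neg = solve-∀

module FibonacciInt where

  open import Data.Nat.Base as ℕ using (zero; suc)
  import Data.Nat.Properties as ℕ
  open import Data.Integer hiding (suc)
  open import Data.Integer.Properties using (pos-+; pos-*; *-assoc)
  open import Relation.Binary.PropositionalEquality
  open import Data.Integer.Tactic.RingSolver using (solve-∀)
  open FibonacciNat using (fib-+)

  F : ℕ → ℤ
  F k = + fib k

  F-suc-suc : ∀ k → F (suc (suc k)) ≡ F (suc k) + F k
  F-suc-suc k = pos-+ (fib (suc k)) (fib k)

  F-+ : ∀ a b → F (suc (a ℕ.+ b)) ≡ F (suc a) * F (suc b) + F a * F b
  F-+ a b = begin
      + fib (suc (a ℕ.+ b))
    ≡⟨ cong +_ (fib-+ a b) ⟩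
      + (fib (suc a) ℕ.* fib (suc b) ℕ.+ fib a ℕ.* fib b)
    ≡⟨ pos-+ (fib (suc a) ℕ.* fib (suc b)) (fib a ℕ.* fib b) ⟩
      + (fib (suc a) ℕ.* fib (suc b)) + + (fib a ℕ.* fib b)
    ≡⟨ cong₂ _+_ (pos-* (fib (suc a)) (fib (suc b))) (pos-* (fib a) (fib b)) ⟩
      F (suc a) * F (suc b) + F a * F b
    ∎
    where open ≡-Reasoning

  d'Ocagne : ∀ j k → F (j ℕ.+ k) * F (suc k) - F (suc (j ℕ.+ k)) * F k ≡ -1ℤ ^ k * F j
  d'Ocagne j zero rewrite ℕ.+-identityʳ j = base (F j) (F (suc j))
    where
    base : ∀ x y → x * 1ℤ - y * 0ℤ ≡ 1ℤ * x
    base = solve-∀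
  d'Ocagne j (suc k) = begin
      F (j ℕ.+ suc k) * F (suc (suc k)) - F (suc (j ℕ.+ suc k)) * F (suc k)
    ≡⟨ cong (λ i → F i * F (suc (suc k)) - F (suc i) * F (suc k)) (ℕ.+-suc j k) ⟩
      B * F (suc (suc k)) - F (suc (suc (j ℕ.+ k))) * d
    ≡⟨ cong₂ (λ x y → B * x - y * d) (F-suc-suc k) (F-suc-suc (j ℕ.+ k)) ⟩
      B * (d + c) - (B + A) * d
    ≡⟨ negate A B c d ⟩
      -1ℤ * (A * d - B * c)
    ≡⟨ cong (-1ℤ *_) (d'Ocagne j k) ⟩
      -1ℤ * (-1ℤ ^ k * F j)
    ≡⟨ sym (*-assoc -1ℤ (-1ℤ ^ k) (F j)) ⟩
      -1ℤ ^ suc k * F j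
    ∎
    where
    open ≡-Reasoning
    A B c d : ℤ
    A = F (j ℕ.+ k)
    B = F (suc (j ℕ.+ k))
    c = F k
    d = F (suc k)
    negate : ∀ A B c d → B * (d + c) - (B + A) * d ≡ -1ℤ * (A * d - B * c)
    negate = solve-∀

module FibonacciModulo (k : ℕ) where

  open import Data.Nat.Base as ℕ using (zero; suc)
  import Data.Nat.Properties as ℕ
  open import Data.Nat.DivMod using (_%_)
  open import Data.Integer hiding (suc; _%_)
  open import Data.Integer.Properties using (*-identityˡ; *-assoc; ^-distribˡ-+-*)
  open import Data.Product using (_×_; _,_)
  open import Data.Sum using (_⊎_; inj₁; inj₂)
  open import Data.Empty using (⊥-elim)
  open import Function.Base using (_$_)
  open import Function.Bundles using (_⇔_; mk⇔)
  import Function.Properties.Equivalence as ⇔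
  open import Relation.Binary.PropositionalEquality
  open import Data.Integer.Tactic.RingSolver using (solve-∀)
  open Signs
  open FibonacciInt

  n : ℕ
  n = 2 ℕ.+ k

  N u ε : ℤ
  N = F n
  u = F (suc k)
  ε = -1ℤ ^ n

  open NaturalModulus (fib n) public

  parity : (ε ≡ 1ℤ × n % 2 ≡ 0) ⊎ (ε ≡ -1ℤ × n % 2 ≡ 1)
  parity = -1^-parity n

  ε≡1⇒even : ε ≡ 1ℤ → n % 2 ≡ 0
  ε≡1⇒even ε≡1 with parity
  ... | inj₁ (_ , even) = even
  ... | inj₂ (ε≡-1 , _) = ⊥-elim (1≢-1 (trans (sym ε≡1) ε≡-1))

  ε≡-1⇒odd : ε ≡ -1ℤ → n % 2 ≡ 1
  ε≡-1⇒odd ε≡-1 with parity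
  ... | inj₁ (ε≡1 , _) = ⊥-elim (1≢-1 (trans (sym ε≡1) ε≡-1))
  ... | inj₂ (_ , odd) = odd

  ε*ε≡1 : ε * ε ≡ 1ℤ
  ε*ε≡1 = -1^-square n

  ε*[ε*x]≡x : ∀ x → ε * (ε * x) ≡ x
  ε*[ε*x]≡x x = trans (sym (*-assoc ε ε x)) (trans (cong (_* x) ε*ε≡1) (*-identityˡ x))

  F-shift : ∀ r → F (n ℕ.+ r) ≈ u * F r
  F-shift r = F (suc r) , trans (F-+ (suc k) r) (swap N (F (suc r)) u (F r))
    where
    swap : ∀ a b c d → a * b + c * d ≡ c * d + b * a
    swap = solve-∀

  cassini : u * u ≈ ε
  cassini = F k , (begin
      u * u                         ≡⟨ split u N (F k) ⟩
      (u * u - N * F k) + F k * N   ≡⟨ cong (_+ F k * N) (d'Ocagne 1 k) ⟩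
      -1ℤ ^ k * 1ℤ + F k * N        ≡⟨ cong (_+ F k * N) (two-signs (-1ℤ ^ k)) ⟩
      ε + F k * N                   ∎)
    where
    open ≡-Reasoning
    split : ∀ u N f → u * u ≡ (u * u - N * f) + f * N
    split = solve-∀
    two-signs : ∀ s → s * 1ℤ ≡ -1ℤ * (-1ℤ * s)
    two-signs = solve-∀

  εu*u≈1 : ε * u * u ≈ 1ℤ
  εu*u≈1 = begin
      ε * u * u   ≡⟨ *-assoc ε u u ⟩
      ε * (u * u) ≈⟨ *-congˡ ε cassini ⟩
      ε * ε       ≡⟨ ε*ε≡1 ⟩
      1ℤ          ∎
    where open ≈-Reasoning

  [εu]^1 : (ε * u) ^ 1 * 1ℤ ≡ ε * u
  [εu]^1 = drop-units (ε * u)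
    where
    drop-units : ∀ x → x * 1ℤ * 1ℤ ≡ x
    drop-units = solve-∀

  [εu]^2 : (ε * u) ^ 2 * 1ℤ ≈ ε
  [εu]^2 = begin
      (ε * u) ^ 2 * 1ℤ   ≡⟨ regroup ε u ⟩
      ε * ε * (u * u)    ≈⟨ *-congˡ (ε * ε) cassini ⟩
      ε * ε * ε          ≡⟨ trans (cong (_* ε) ε*ε≡1) (*-identityˡ ε) ⟩
      ε                  ∎
    where
    open ≈-Reasoning
    regroup : ∀ e u → e * u * (e * u * 1ℤ) * 1ℤ ≡ e * e * (u * u)
    regroup = solve-∀

  [εu]^3 : (ε * u) ^ 3 * 1ℤ ≈ u
  [εu]^3 = begin
      (ε * u) ^ 3 * 1ℤ              ≡⟨ regroup ε u ⟩
      ε * ε * (ε * (u * u * u))     ≈⟨ *-congˡ (ε * ε) (*-congˡ ε (*-congʳ u cassini)) ⟩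
      ε * ε * (ε * (ε * u))         ≡⟨ cong₂ _*_ ε*ε≡1 (ε*[ε*x]≡x u) ⟩
      1ℤ * u                        ≡⟨ *-identityˡ u ⟩
      u                             ∎
    where
    open ≈-Reasoning
    regroup : ∀ e u → e * u * (e * u * (e * u * 1ℤ)) * 1ℤ ≡ e * e * (e * (u * u * u))
    regroup = solve-∀

  F-shift-⇔ : ∀ r X Y → F (n ℕ.+ r) * X ≈ Y ⇔ F r * X ≈ ε * u * Y
  F-shift-⇔ r X Y = mk⇔ to from
    where
    open ≈-Reasoning
    to : F (n ℕ.+ r) * X ≈ Y → F r * X ≈ ε * u * Y
    to h = begin
      F r * X                   ≡⟨ sym (*-identityˡ (F r * X)) ⟩
      1ℤ * (F r * X)            ≈⟨ *-congʳ (F r * X) (≈-sym εu*u≈1) ⟩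
      ε * u * u * (F r * X)     ≡⟨ regroup (ε * u) u (F r) X ⟩
      ε * u * (u * F r * X)     ≈⟨ *-congˡ (ε * u) (*-congʳ X (≈-sym (F-shift r))) ⟩
      ε * u * (F (n ℕ.+ r) * X) ≈⟨ *-congˡ (ε * u) h ⟩
      ε * u * Y                 ∎
      where
      regroup : ∀ a b c d → a * b * (c * d) ≡ a * (b * c * d)
      regroup = solve-∀
    from : F r * X ≈ ε * u * Y → F (n ℕ.+ r) * X ≈ Y
    from h = begin
      F (n ℕ.+ r) * X           ≈⟨ *-congʳ X (F-shift r) ⟩
      u * F r * X               ≡⟨ *-assoc u (F r) X ⟩
      u * (F r * X)             ≈⟨ *-congˡ u h ⟩
      u * (ε * u * Y)           ≡⟨ regroup u ε Y ⟩
      ε * u * u * Y             ≈⟨ *-congʳ Y εu*u≈1 ⟩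
      1ℤ * Y                    ≡⟨ *-identityˡ Y ⟩
      Y                         ∎
      where
      regroup : ∀ u e y → u * (e * u * y) ≡ e * u * u * y
      regroup = solve-∀

  F-shift-multiple-⇔ : ∀ q r X Y → F (q ℕ.* n ℕ.+ r) * X ≈ Y ⇔ F r * X ≈ (ε * u) ^ q * Y
  F-shift-multiple-⇔ zero r X Y = ≈-respʳ-⇔ (≈-reflexive (sym (*-identityˡ Y)))
  F-shift-multiple-⇔ (suc q) r X Y =
    subst (λ i → F i * X ≈ Y ⇔ F r * X ≈ (ε * u) ^ suc q * Y) (sym (ℕ.+-assoc n (q ℕ.* n) r)) $
    ⇔.trans (F-shift-⇔ (q ℕ.* n ℕ.+ r) X Y)
      (⇔.trans (F-shift-multiple-⇔ q r X (ε * u * Y))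
        (≈-respʳ-⇔ (≈-reflexive (regroup (ε * u) ((ε * u) ^ q) Y))))
    where
    regroup : ∀ a b y → b * (a * y) ≡ a * b * y
    regroup = solve-∀

  reflection : ∀ a b → a ℕ.+ suc b ≡ n → u * F (suc b) ≈ -1ℤ ^ b * F a
  reflection a b a+1+b≡n = F b , (begin
      u * F (suc b)                         ≡⟨ split u (F (suc b)) N (F b) ⟩
      (u * F (suc b) - N * F b) + F b * N   ≡⟨ cong (_+ F b * N) d'Ocagne[a,b] ⟩
      -1ℤ ^ b * F a + F b * N               ∎)
    where
    open ≡-Reasoning
    d'Ocagne[a,b] : u * F (suc b) - N * F b ≡ -1ℤ ^ b * F a
    d'Ocagne[a,b] = subst (λ i → F i * F (suc b) - F (suc i) * F b ≡ -1ℤ ^ b * F a)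
                      (ℕ.suc-injective (trans (sym (ℕ.+-suc a b)) a+1+b≡n)) (d'Ocagne a b)
    split : ∀ u f N g → u * f ≡ (u * f - N * g) + g * N
    split = solve-∀

  reflected-product : ∀ a b c d → a ℕ.+ suc b ≡ n → c ℕ.+ suc d ≡ n →
    F (suc b) * F (suc d) ≈ -1ℤ ^ (b ℕ.+ d) * (ε * (F a * F c))
  reflected-product a b c d a+1+b≡n c+1+d≡n = begin
      F (suc b) * F (suc d)                     ≡⟨ sym (ε*[ε*x]≡x _) ⟩
      ε * (ε * (F (suc b) * F (suc d)))         ≈⟨ *-congˡ ε (*-congʳ _ (≈-sym cassini)) ⟩
      ε * (u * u * (F (suc b) * F (suc d)))     ≡⟨ cong (ε *_) (regroup u (F (suc b)) (F (suc d))) ⟩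
      ε * ((u * F (suc b)) * (u * F (suc d)))   ≈⟨ *-congˡ ε (*-cong (reflection a b a+1+b≡n) (reflection c d c+1+d≡n)) ⟩
      ε * ((-1ℤ ^ b * F a) * (-1ℤ ^ d * F c))   ≡⟨ regroup′ ε (-1ℤ ^ b) (-1ℤ ^ d) (F a) (F c) ⟩
      -1ℤ ^ b * -1ℤ ^ d * (ε * (F a * F c))     ≡⟨ cong (_* (ε * (F a * F c))) (sym (^-distribˡ-+-* -1ℤ b d)) ⟩
      -1ℤ ^ (b ℕ.+ d) * (ε * (F a * F c))       ∎
    where
    open ≈-Reasoning
    regroup : ∀ u f g → u * u * (f * g) ≡ (u * f) * (u * g)
    regroup = solve-∀
    regroup′ : ∀ e s t f g → e * ((s * f) * (t * g)) ≡ s * t * (e * (f * g))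
    regroup′ = solve-∀

module Classification (p : ℕ) where

  open import Data.Nat.Base as ℕ using (suc; _≤_; _<_; z≤n; s≤s)
  import Data.Nat.Properties as ℕ
  open import Data.Integer using (ℤ; +_; -_; _+_; _*_; _^_; 1ℤ; -1ℤ)
  open import Data.Integer.Properties using (pos-*; pos-+; *-identityˡ; neg-injective; -1*i≡-i)
  open import Data.Product using (_×_; _,_; proj₂)
  open import Data.Sum using (_⊎_; inj₁; inj₂)
  open import Data.Empty using (⊥-elim)
  open import Relation.Binary.PropositionalEquality
  open import Data.Integer.Tactic.RingSolver using (solve-∀)
  open FibonacciNat
  open Signs
  open FibonacciInt using (F; F-suc-suc)

  open FibonacciModulo (2 ℕ.+ p) public

  w : ℤ
  w = F (2 ℕ.+ p)

  -u≈w : - u ≈ w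
  -u≈w = -1ℤ , trans (shift u w) (cong (λ N → w + -1ℤ * N) (sym (F-suc-suc (2 ℕ.+ p))))
    where
    shift : ∀ u w → - u ≡ w + -1ℤ * (u + w)
    shift = solve-∀

  w*w≈ε : w * w ≈ ε
  w*w≈ε = begin
      w * w         ≈⟨ ≈-sym (*-cong -u≈w -u≈w) ⟩
      - u * - u     ≡⟨ neg-square u ⟩
      u * u         ≈⟨ cassini ⟩
      ε             ∎
    where
    open ≈-Reasoning
    neg-square : ∀ u → - u * - u ≡ u * u
    neg-square = solve-∀

  u*w≈-ε : u * w ≈ - ε
  u*w≈-ε = begin
      u * w         ≈⟨ *-congˡ u (≈-sym -u≈w) ⟩
      u * - u       ≡⟨ neg-right u ⟩
      -1ℤ * (u * u) ≈⟨ *-congˡ -1ℤ cassini ⟩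
      -1ℤ * ε       ≡⟨ -1*i≡-i ε ⟩
      - ε           ∎
    where
    open ≈-Reasoning
    neg-right : ∀ u → u * - u ≡ -1ℤ * (u * u)
    neg-right = solve-∀

  ε≡-1^p : ε ≡ -1ℤ ^ p
  ε≡-1^p = trans (double-negation _) (double-negation _)

  p≡0⇒ε≡1 : p ≡ 0 → ε ≡ 1ℤ
  p≡0⇒ε≡1 p≡0 = trans ε≡-1^p (cong (-1ℤ ^_) p≡0)

  -1^[1+p]≡-1⇒ε≡1 : ∀ {j} → j ≡ suc p → -1ℤ ^ j ≡ -1ℤ → ε ≡ 1ℤ
  -1^[1+p]≡-1⇒ε≡1 refl sign≡-1 = trans ε≡-1^p (neg-injective (trans (sym (-1*i≡-i (-1ℤ ^ p))) sign≡-1))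

  1<N : 1 < fib n
  1<N = 2≤fib {n} (s≤s (s≤s (s≤s z≤n)))

  F*F≈+c⇒fib*fib≡c : ∀ x y {c} → x ℕ.+ y ≤ n → c < fib n → F x * F y ≈ + c → fib x ℕ.* fib y ≡ c
  F*F≈+c⇒fib*fib≡c x y {c} x+y≤n c<N xy≈c =
    ≈⇒≡ (fib*fib<fib x y x+y≤n (s≤s (s≤s (s≤s z≤n)))) c<N
      (subst (λ z → z ≈ + c) (sym (pos-* (fib x) (fib y))) xy≈c)

  F*F≈1⇒ : ∀ x y → x ℕ.+ y ≤ n → F x * F y ≈ 1ℤ → (x ≡ 1 ⊎ x ≡ 2) × (y ≡ 1 ⊎ y ≡ 2)
  F*F≈1⇒ x y x+y≤n xy≈1 = fib*fib≡1 x y (F*F≈+c⇒fib*fib≡c x y x+y≤n 1<N xy≈1)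

  F*F≈-1⇒ : ∀ x y → x ℕ.+ y ≤ n → F x * F y ≈ -1ℤ → p ≡ 0 × x ℕ.+ y ≡ n
  F*F≈-1⇒ x y x+y≤n xy≈-1 with ℕ.m≤n⇒∃[o]m+o≡n (ℕ.<⇒≤ 1<N)
  ... | o , 1+o≡N = fib*fib≡fib∸1 {x} {y} p x+y≤n (trans (cong suc xy≡o) 1+o≡N)
    where
    -1≈o : -1ℤ ≈ + o
    -1≈o = -1ℤ , trans (wrap (+ o)) (cong (λ N → + o + -1ℤ * N) (trans (sym (pos-+ 1 o)) (cong +_ 1+o≡N)))
      where
      wrap : ∀ o → -1ℤ ≡ o + -1ℤ * (1ℤ + o)
      wrap = solve-∀
    xy≡o : fib x ℕ.* fib y ≡ o
    xy≡o = F*F≈+c⇒fib*fib≡c x y x+y≤n (subst (o <_) 1+o≡N (ℕ.n<1+n o)) (≈-trans xy≈-1 -1≈o)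

  fib≡fib[3+p]⇒ : ∀ {z} → fib z ≡ fib (3 ℕ.+ p) → z ≡ 3 ℕ.+ p
  fib≡fib[3+p]⇒ = fib-injective (s≤s (s≤s (s≤s z≤n)))

  F*F≈u⇒ : ∀ x y → x ℕ.+ y ≤ n → F x * F y ≈ u → (x ≡ 1 × y ≡ 3 ℕ.+ p) ⊎ (y ≡ 1 × x ≡ 3 ℕ.+ p)
  F*F≈u⇒ x y x+y≤n xy≈u
    with fib*fib≡fib {x} {y} {3 ℕ.+ p} (s≤s (s≤s z≤n)) (F*F≈+c⇒fib*fib≡c x y x+y≤n (fib-<-suc (suc p)) xy≈u)
  ... | inj₁ (inj₁ x≡1 , fy≡) = inj₁ (x≡1 , fib≡fib[3+p]⇒ fy≡)
  ... | inj₂ (inj₁ y≡1 , fx≡) = inj₂ (y≡1 , fib≡fib[3+p]⇒ fx≡)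
  ... | inj₁ (inj₂ refl , fy≡) = ⊥-elim (ℕ.<-irrefl refl (subst (λ y → 2 ℕ.+ y ≤ n) (fib≡fib[3+p]⇒ fy≡) x+y≤n))
  ... | inj₂ (inj₂ refl , fx≡) =
          ⊥-elim (ℕ.<-irrefl refl
            (subst (λ x → 2 ℕ.+ x ≤ n) (fib≡fib[3+p]⇒ fx≡) (subst (_≤ n) (ℕ.+-comm x 2) x+y≤n)))

  F*F≈-u⇒ : ∀ x y → x ℕ.+ y ≤ n → F x * F y ≈ - u →
    ((x ≡ 1 ⊎ x ≡ 2) × y ≡ 2 ℕ.+ p) ⊎ ((y ≡ 1 ⊎ y ≡ 2) × x ≡ 2 ℕ.+ p) ⊎ (p ≡ 0 × x ≡ 1 × y ≡ 1)
  F*F≈-u⇒ x y x+y≤n xy≈-u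
    with fib*fib≡fib {x} {y} {2 ℕ.+ p} (s≤s (s≤s z≤n))
           (F*F≈+c⇒fib*fib≡c x y x+y≤n (fib-mono-< {2 ℕ.+ p} (s≤s (s≤s z≤n)) (s≤s (s≤s (ℕ.n≤1+n _))))
             (≈-trans xy≈-u -u≈w))
  ... | inj₁ (x∈ , fy≡) with fib≡fib[2+k]⇒ p fy≡
  ...   | inj₁ y≡2+p = inj₁ (x∈ , y≡2+p)
  ...   | inj₂ (p≡0 , y≡1) with x∈
  ...     | inj₁ x≡1 = inj₂ (inj₂ (p≡0 , x≡1 , y≡1))
  ...     | inj₂ x≡2 = inj₂ (inj₁ (inj₁ y≡1 , trans x≡2 (cong (2 ℕ.+_) (sym p≡0))))
  F*F≈-u⇒ x y x+y≤n xy≈-u | inj₂ (y∈ , fx≡) with fib≡fib[2+k]⇒ p fx≡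
  ...   | inj₁ x≡2+p = inj₂ (inj₁ (y∈ , x≡2+p))
  ...   | inj₂ (p≡0 , x≡1) with y∈
  ...     | inj₁ y≡1 = inj₂ (inj₂ (p≡0 , x≡1 , y≡1))
  ...     | inj₂ y≡2 = inj₁ (inj₁ x≡1 , trans y≡2 (cong (2 ℕ.+_) (sym p≡0)))

  F*F≈±1⇒ : ∀ x y {s} → x ℕ.+ y < n → ±1 s → F x * F y ≈ s →
    s ≡ 1ℤ × (x ≡ 1 ⊎ x ≡ 2) × (y ≡ 1 ⊎ y ≡ 2)
  F*F≈±1⇒ x y x+y<n (inj₁ refl) xy≈1 = refl , F*F≈1⇒ x y (ℕ.<⇒≤ x+y<n) xy≈1
  F*F≈±1⇒ x y x+y<n (inj₂ refl) xy≈-1 = ⊥-elim (ℕ.<-irrefl (proj₂ (F*F≈-1⇒ x y (ℕ.<⇒≤ x+y<n) xy≈-1)) x+y<n)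

  F*F≈±u⇒ : ∀ x y {s} → x ℕ.+ y < n → ±1 s → F x * F y ≈ s * u →
    s ≡ -1ℤ × ((x ≡ 1 × y ≡ 2 ℕ.+ p) ⊎ (y ≡ 1 × x ≡ 2 ℕ.+ p) ⊎ (p ≡ 0 × x ≡ 1 × y ≡ 1))
  F*F≈±u⇒ x y x+y<n (inj₁ refl) xy≈u with F*F≈u⇒ x y (ℕ.<⇒≤ x+y<n) (≈-trans xy≈u (≈-reflexive (*-identityˡ u)))
  ... | inj₁ (refl , refl) = ⊥-elim (ℕ.<-irrefl refl x+y<n)
  ... | inj₂ (refl , refl) = ⊥-elim (ℕ.<-irrefl (ℕ.+-comm x 1) x+y<n)
  F*F≈±u⇒ x y x+y<n (inj₂ refl) xy≈-u with F*F≈-u⇒ x y (ℕ.<⇒≤ x+y<n) (≈-trans xy≈-u (≈-reflexive (-1*i≡-i u)))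
  ... | inj₁ (inj₁ x≡1 , y≡2+p) = refl , inj₁ (x≡1 , y≡2+p)
  ... | inj₁ (inj₂ refl , refl) = ⊥-elim (ℕ.<-irrefl refl x+y<n)
  ... | inj₂ (inj₁ (inj₁ y≡1 , x≡2+p)) = refl , inj₂ (inj₁ (y≡1 , x≡2+p))
  ... | inj₂ (inj₁ (inj₂ refl , refl)) = ⊥-elim (ℕ.<-irrefl (ℕ.+-comm x 2) x+y<n)
  ... | inj₂ (inj₂ p≡0×x≡1×y≡1) = refl , inj₂ (inj₂ p≡0×x≡1×y≡1)

module Inverses (p : ℕ) where

  open import Data.Nat.Base as ℕ using (suc; _≤_; _<_; _∸_; z≤n; s≤s)
  import Data.Nat.Properties as ℕ
  open import Data.Nat.DivMod using (_/_; _%_; m≡m%n+[m/n]*n; m%n<n; m<n*o⇒m/o<n)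
  open import Data.Integer using (-_; _*_; _^_; 1ℤ; -1ℤ)
  open import Data.Integer.Properties using (*-identityˡ; *-identityʳ; *-assoc; *-comm; -1*i≡-i)
  open import Data.Product using (_×_; _,_; proj₁)
  open import Data.Sum using (_⊎_; inj₁; inj₂)
  open import Data.Empty using (⊥-elim)
  open import Function.Bundles using (_⇔_; mk⇔; Equivalence)
  open import Relation.Nullary using (yes; no)
  open import Relation.Binary.PropositionalEquality
  import Data.Nat.Tactic.RingSolver as ℕ-Solver
  open Signs
  open FibonacciInt using (F)
  open Classification p

  data Position : ℕ → ℕ → Set where
    within    : ∀ {r ℓ} → r ℕ.+ ℓ ≤ n → Position r ℓ
    reflected : ∀ a b → suc a ℕ.+ suc b < n → Position (n ∸ suc a) (n ∸ suc b)

  position : ∀ {r ℓ} → r < n → ℓ < n → Position r ℓ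
  position {r} {ℓ} r<n ℓ<n with r ℕ.+ ℓ ℕ.≤? n | ℕ.m≤n⇒∃[o]m+o≡n r<n | ℕ.m≤n⇒∃[o]m+o≡n ℓ<n
  ... | yes r+ℓ≤n | _ | _ = within r+ℓ≤n
  ... | no r+ℓ≰n | a , 1+r+a≡n | b , 1+ℓ+b≡n =
    subst₂ Position (complement 1+r+a≡n) (complement 1+ℓ+b≡n) (reflected a b bound)
    where
    complement : ∀ {x y} → suc x ℕ.+ y ≡ n → n ∸ suc y ≡ x
    complement {x} {y} eq = trans (cong (_∸ suc y) (trans (sym eq) (sym (ℕ.+-suc x y)))) (ℕ.m+n∸n≡m x (suc y))
    bound : suc a ℕ.+ suc b < n
    bound = ℕ.+-cancelʳ-< (r ℕ.+ ℓ) (suc a ℕ.+ suc b) n (begin-strict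
        suc a ℕ.+ suc b ℕ.+ (r ℕ.+ ℓ)     ≡⟨ regroup a b r ℓ ⟩
        (suc r ℕ.+ a) ℕ.+ (suc ℓ ℕ.+ b)   ≡⟨ cong₂ ℕ._+_ 1+r+a≡n 1+ℓ+b≡n ⟩
        n ℕ.+ n                           <⟨ ℕ.+-monoʳ-< n (ℕ.≰⇒> r+ℓ≰n) ⟩
        n ℕ.+ (r ℕ.+ ℓ)                   ∎)
      where
      open ℕ.≤-Reasoning
      regroup : ∀ a b r ℓ → suc a ℕ.+ suc b ℕ.+ (r ℕ.+ ℓ) ≡ (suc r ℕ.+ a) ℕ.+ (suc ℓ ℕ.+ b)
      regroup = ℕ-Solver.solve-∀

  reflected-≈ : ∀ a b T → suc a ℕ.+ suc b < n → F (n ∸ suc a) * F (n ∸ suc b) ≈ T →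
    F (suc a) * F (suc b) ≈ -1ℤ ^ (a ℕ.+ b) * (ε * T)
  reflected-≈ a b T bound h = ≈-trans
      (reflected-product (n ∸ suc a) a (n ∸ suc b) b (ℕ.m∸n+n≡m (ℕ.<⇒≤ 1+a<n)) (ℕ.m∸n+n≡m (ℕ.<⇒≤ 1+b<n)))
      (*-congˡ (-1ℤ ^ (a ℕ.+ b)) (*-congˡ ε h))
    where
    1+a<n : suc a < n
    1+a<n = ℕ.≤-<-trans (ℕ.m≤m+n (suc a) (suc b)) bound
    1+b<n : suc b < n
    1+b<n = ℕ.≤-<-trans (ℕ.m≤n+m (suc b) (suc a)) bound

  data Solution (ℓ m : ℕ) : Set where
    c1-even : ε ≡ 1ℤ  → ℓ ≡ n ∸ 2 → m ≡ n ∸ 2 → Solution ℓ m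
    c1-odd  : ε ≡ -1ℤ → ℓ ≡ n ∸ 1 → m ≡ n ∸ 2 → Solution ℓ m
    c2-even : ε ≡ 1ℤ  → ℓ ≡ n ∸ 1 → m ≡ n ∸ 1 ⊎ m ≡ n ℕ.+ 1 ⊎ m ≡ n ℕ.+ 2 → Solution ℓ m
    c2-odd  : ε ≡ -1ℤ → ℓ ≡ n ∸ 2 → m ≡ n ∸ 1 ⊎ m ≡ n ℕ.+ 1 ⊎ m ≡ n ℕ.+ 2 → Solution ℓ m
    c3      : ε ≡ -1ℤ → ℓ ≡ 2 → m ≡ 2 ℕ.* n ∸ 2 → Solution ℓ m
    c4      : ε ≡ 1ℤ  → ℓ ≡ 2 → m ≡ 2 ℕ.* n ∸ 1 ⊎ m ≡ 2 ℕ.* n ℕ.+ 1 ⊎ m ≡ 2 ℕ.* n ℕ.+ 2 → Solution ℓ m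
    c5      : ℓ ≡ n ∸ 2 → m ≡ 3 ℕ.* n ∸ 2 → Solution ℓ m
    c6      : ℓ ≡ n ∸ 1 → m ≡ 3 ℕ.* n ∸ 1 ⊎ m ≡ 3 ℕ.* n ℕ.+ 1 ⊎ m ≡ 3 ℕ.* n ℕ.+ 2 → Solution ℓ m
    c7      : ℓ ≡ 2 → m ≡ 4 ℕ.* n ∸ 1 → Solution ℓ m

  ε-±1 : ±1 ε
  ε-±1 = -1^-±1 n

  q*n+[n∸j]≡[1+q]*n∸j : ∀ q {j r} → j ≤ n → r ≡ n ∸ j → q ℕ.* n ℕ.+ r ≡ suc q ℕ.* n ∸ j
  q*n+[n∸j]≡[1+q]*n∸j q {j} j≤n refl = sym (trans (ℕ.+-∸-comm (q ℕ.* n) j≤n) (ℕ.+-comm (n ∸ j) (q ℕ.* n)))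

  1*n+r≡n+j : ∀ {r j} → r ≡ j → 1 ℕ.* n ℕ.+ r ≡ n ℕ.+ j
  1*n+r≡n+j = cong₂ ℕ._+_ (ℕ.*-identityˡ n)

  n∸[2+p]≡2 : n ∸ (2 ℕ.+ p) ≡ 2
  n∸[2+p]≡2 = ℕ.m+n∸n≡m 2 (2 ℕ.+ p)

  2≤ℓ⇒ℓ≢1 : ∀ {ℓ} → 2 ≤ ℓ → ℓ ≢ 1
  2≤ℓ⇒ℓ≢1 (s≤s ()) refl

  solution-quotient-0 : ∀ {r ℓ} → 3 ≤ r → Position r ℓ → F r * F ℓ ≈ 1ℤ → Solution ℓ r
  solution-quotient-0 {r} {ℓ} 3≤r (within r+ℓ≤n) h with proj₁ (F*F≈1⇒ r ℓ r+ℓ≤n h)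
  solution-quotient-0 (s≤s ()) (within _) h | inj₁ refl
  solution-quotient-0 (s≤s (s≤s ())) (within _) h | inj₂ refl
  solution-quotient-0 _ (reflected a b bound) h =
    from-reflected a b (F*F≈±1⇒ (suc a) (suc b) bound (±1-* (-1^-±1 (a ℕ.+ b)) ε-±1)
      (≈-trans (reflected-≈ a b 1ℤ bound h) (≈-reflexive (cong (-1ℤ ^ (a ℕ.+ b) *_) (*-identityʳ ε)))))
    where
    from-reflected : ∀ a b → -1ℤ ^ (a ℕ.+ b) * ε ≡ 1ℤ × (suc a ≡ 1 ⊎ suc a ≡ 2) × (suc b ≡ 1 ⊎ suc b ≡ 2) →
      Solution (n ∸ suc b) (n ∸ suc a)
    from-reflected _ _ (sign≡1 , inj₁ refl , inj₁ refl) = c2-even (trans (sym (*-identityˡ ε)) sign≡1) refl (inj₁ refl)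
    from-reflected _ _ (sign≡1 , inj₂ refl , inj₂ refl) = c1-even (trans (sym (*-identityˡ ε)) sign≡1) refl refl
    from-reflected _ _ (sign≡1 , inj₁ refl , inj₂ refl) = c2-odd (-1*s≡1⇒s≡-1 sign≡1) refl (inj₁ refl)
    from-reflected _ _ (sign≡1 , inj₂ refl , inj₁ refl) = c1-odd (-1*s≡1⇒s≡-1 sign≡1) refl refl

  solution-quotient-1 : ∀ {r ℓ} → 2 ≤ ℓ → Position r ℓ → F r * F ℓ ≈ ε * u → Solution ℓ (1 ℕ.* n ℕ.+ r)
  solution-quotient-1 {r} {ℓ} 2≤ℓ (within r+ℓ≤n) h with ε-±1
  ... | inj₁ ε≡1 with F*F≈u⇒ r ℓ r+ℓ≤n (≈-trans h (≈-reflexive (trans (cong (_* u) ε≡1) (*-identityˡ u))))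
  ...   | inj₁ (r≡1 , ℓ≡n∸1) = c2-even ε≡1 ℓ≡n∸1 (inj₂ (inj₁ (1*n+r≡n+j r≡1)))
  ...   | inj₂ (ℓ≡1 , _) = ⊥-elim (2≤ℓ⇒ℓ≢1 2≤ℓ ℓ≡1)
  solution-quotient-1 {r} {ℓ} 2≤ℓ (within r+ℓ≤n) h | inj₂ ε≡-1
    with F*F≈-u⇒ r ℓ r+ℓ≤n (≈-trans h (≈-reflexive (trans (cong (_* u) ε≡-1) (-1*i≡-i u))))
  ... | inj₁ (inj₁ r≡1 , ℓ≡n∸2) = c2-odd ε≡-1 ℓ≡n∸2 (inj₂ (inj₁ (1*n+r≡n+j r≡1)))
  ... | inj₁ (inj₂ r≡2 , ℓ≡n∸2) = c2-odd ε≡-1 ℓ≡n∸2 (inj₂ (inj₂ (1*n+r≡n+j r≡2)))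
  ... | inj₂ (inj₁ (inj₁ ℓ≡1 , _)) = ⊥-elim (2≤ℓ⇒ℓ≢1 2≤ℓ ℓ≡1)
  ... | inj₂ (inj₁ (inj₂ ℓ≡2 , r≡n∸2)) = c3 ε≡-1 ℓ≡2 (q*n+[n∸j]≡[1+q]*n∸j 1 (ℕ.m≤m+n 2 (2 ℕ.+ p)) r≡n∸2)
  ... | inj₂ (inj₂ (_ , _ , ℓ≡1)) = ⊥-elim (2≤ℓ⇒ℓ≢1 2≤ℓ ℓ≡1)
  solution-quotient-1 _ (reflected a b bound) h =
    from-reflected a b (F*F≈±u⇒ (suc a) (suc b) bound (-1^-±1 (a ℕ.+ b))
      (≈-trans (reflected-≈ a b (ε * u) bound h) (≈-reflexive (cong (-1ℤ ^ (a ℕ.+ b) *_) (ε*[ε*x]≡x u)))))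
    where
    from-reflected : ∀ a b → -1ℤ ^ (a ℕ.+ b) ≡ -1ℤ ×
      ((suc a ≡ 1 × suc b ≡ 2 ℕ.+ p) ⊎ (suc b ≡ 1 × suc a ≡ 2 ℕ.+ p) ⊎ (p ≡ 0 × suc a ≡ 1 × suc b ≡ 1)) →
      Solution (n ∸ suc b) (1 ℕ.* n ℕ.+ (n ∸ suc a))
    from-reflected _ _ (sign≡-1 , inj₁ (refl , refl)) =
      c4 (-1^[1+p]≡-1⇒ε≡1 refl sign≡-1) n∸[2+p]≡2 (inj₁ (q*n+[n∸j]≡[1+q]*n∸j 1 (s≤s z≤n) refl))
    from-reflected _ _ (sign≡-1 , inj₂ (inj₁ (refl , refl))) =
      c2-even (-1^[1+p]≡-1⇒ε≡1 (ℕ.+-identityʳ (suc p)) sign≡-1) refl (inj₂ (inj₂ (1*n+r≡n+j n∸[2+p]≡2)))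
    from-reflected _ _ (() , inj₂ (inj₂ (_ , refl , refl)))

  solution-quotient-2 : ∀ {r ℓ} → 2 ≤ ℓ → Position r ℓ → F r * F ℓ ≈ ε → Solution ℓ (2 ℕ.* n ℕ.+ r)
  solution-quotient-2 {r} {ℓ} 2≤ℓ (within r+ℓ≤n) h with ε-±1
  ... | inj₁ ε≡1 with F*F≈1⇒ r ℓ r+ℓ≤n (≈-trans h (≈-reflexive ε≡1))
  ...   | _ , inj₁ ℓ≡1 = ⊥-elim (2≤ℓ⇒ℓ≢1 2≤ℓ ℓ≡1)
  ...   | inj₁ r≡1 , inj₂ ℓ≡2 = c4 ε≡1 ℓ≡2 (inj₂ (inj₁ (cong (2 ℕ.* n ℕ.+_) r≡1)))
  ...   | inj₂ r≡2 , inj₂ ℓ≡2 = c4 ε≡1 ℓ≡2 (inj₂ (inj₂ (cong (2 ℕ.* n ℕ.+_) r≡2)))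
  solution-quotient-2 {r} {ℓ} 2≤ℓ (within r+ℓ≤n) h | inj₂ ε≡-1 =
    ⊥-elim (1≢-1 (trans (sym (p≡0⇒ε≡1 p≡0)) ε≡-1))
    where
    p≡0 : p ≡ 0
    p≡0 = proj₁ (F*F≈-1⇒ r ℓ r+ℓ≤n (≈-trans h (≈-reflexive ε≡-1)))
  solution-quotient-2 _ (reflected a b bound) h =
    from-reflected a b (F*F≈±1⇒ (suc a) (suc b) bound (-1^-±1 (a ℕ.+ b))
      (≈-trans (reflected-≈ a b ε bound h) (≈-reflexive (trans (cong (-1ℤ ^ (a ℕ.+ b) *_) ε*ε≡1) (*-identityʳ _)))))
    where
    from-reflected : ∀ a b → -1ℤ ^ (a ℕ.+ b) ≡ 1ℤ × (suc a ≡ 1 ⊎ suc a ≡ 2) × (suc b ≡ 1 ⊎ suc b ≡ 2) →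
      Solution (n ∸ suc b) (2 ℕ.* n ℕ.+ (n ∸ suc a))
    from-reflected _ _ (_ , inj₁ refl , inj₁ refl) = c6 refl (inj₁ (q*n+[n∸j]≡[1+q]*n∸j 2 (s≤s z≤n) refl))
    from-reflected _ _ (_ , inj₂ refl , inj₂ refl) = c5 refl (q*n+[n∸j]≡[1+q]*n∸j 2 (s≤s (s≤s z≤n)) refl)
    from-reflected _ _ (() , inj₁ refl , inj₂ refl)
    from-reflected _ _ (() , inj₂ refl , inj₁ refl)

  solution-quotient-3 : ∀ {r ℓ} → 2 ≤ ℓ → Position r ℓ → F r * F ℓ ≈ u → Solution ℓ (3 ℕ.* n ℕ.+ r)
  solution-quotient-3 {r} {ℓ} 2≤ℓ (within r+ℓ≤n) h with F*F≈u⇒ r ℓ r+ℓ≤n h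
  ... | inj₁ (r≡1 , ℓ≡n∸1) = c6 ℓ≡n∸1 (inj₂ (inj₁ (cong (3 ℕ.* n ℕ.+_) r≡1)))
  ... | inj₂ (ℓ≡1 , _) = ⊥-elim (2≤ℓ⇒ℓ≢1 2≤ℓ ℓ≡1)
  solution-quotient-3 _ (reflected a b bound) h =
    from-reflected a b (F*F≈±u⇒ (suc a) (suc b) bound (±1-* (-1^-±1 (a ℕ.+ b)) ε-±1)
      (≈-trans (reflected-≈ a b u bound h) (≈-reflexive (sym (*-assoc (-1ℤ ^ (a ℕ.+ b)) ε u)))))
    where
    from-reflected : ∀ a b → -1ℤ ^ (a ℕ.+ b) * ε ≡ -1ℤ ×
      ((suc a ≡ 1 × suc b ≡ 2 ℕ.+ p) ⊎ (suc b ≡ 1 × suc a ≡ 2 ℕ.+ p) ⊎ (p ≡ 0 × suc a ≡ 1 × suc b ≡ 1)) →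
      Solution (n ∸ suc b) (3 ℕ.* n ℕ.+ (n ∸ suc a))
    from-reflected _ _ (_ , inj₁ (refl , refl)) = c7 n∸[2+p]≡2 (q*n+[n∸j]≡[1+q]*n∸j 3 (s≤s z≤n) refl)
    from-reflected _ _ (_ , inj₂ (inj₁ (refl , refl))) = c6 refl (inj₂ (inj₂ (cong (3 ℕ.* n ℕ.+_) n∸[2+p]≡2)))
    from-reflected _ _ (sign≡-1 , inj₂ (inj₂ (p≡0 , refl , refl))) =
      ⊥-elim (1≢-1 (trans (sym (cong (1ℤ *_) (p≡0⇒ε≡1 p≡0))) sign≡-1))

  inverse⇒Solution : ∀ {ℓ m} → 2 ≤ ℓ → ℓ < n → 3 ≤ m → m < 4 ℕ.* n → F m * F ℓ ≈ 1ℤ → Solution ℓ m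
  inverse⇒Solution {ℓ} {m} 2≤ℓ ℓ<n 3≤m m<4n h =
    subst (Solution ℓ) (sym m≡qn+r)
      (by-quotient (m / n) (m<n*o⇒m/o<n m<4n) (subst (3 ≤_) m≡qn+r 3≤m) (position (m%n<n m n) ℓ<n)
        (Equivalence.to (F-shift-multiple-⇔ (m / n) (m % n) (F ℓ) 1ℤ) (subst (λ i → F i * F ℓ ≈ 1ℤ) m≡qn+r h)))
    where
    m≡qn+r : m ≡ m / n ℕ.* n ℕ.+ m % n
    m≡qn+r = trans (m≡m%n+[m/n]*n m n) (ℕ.+-comm (m % n) _)
    by-quotient : ∀ q {r} → q < 4 → 3 ≤ q ℕ.* n ℕ.+ r → Position r ℓ → F r * F ℓ ≈ (ε * u) ^ q * 1ℤ →
      Solution ℓ (q ℕ.* n ℕ.+ r)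
    by-quotient 0 _ 3≤r pos h = solution-quotient-0 3≤r pos h
    by-quotient 1 _ _ pos h = solution-quotient-1 2≤ℓ pos (≈-trans h (≈-reflexive [εu]^1))
    by-quotient 2 _ _ pos h = solution-quotient-2 2≤ℓ pos (≈-trans h [εu]^2)
    by-quotient 3 _ _ pos h = solution-quotient-3 2≤ℓ pos (≈-trans h [εu]^3)
    by-quotient (suc (suc (suc (suc _)))) (s≤s (s≤s (s≤s (s≤s ())))) _ _ _

  via-quotient : ∀ q r ℓ {m T} → (ε * u) ^ q * 1ℤ ≈ T → m ≡ q ℕ.* n ℕ.+ r → F r * F ℓ ≈ T → F m * F ℓ ≈ 1ℤ
  via-quotient q r ℓ unit refl h = Equivalence.from (F-shift-multiple-⇔ q r (F ℓ) 1ℤ) (≈-trans h (≈-sym unit))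

  via-quotient-1 : ∀ r ℓ {m} → m ≡ 1 ℕ.* n ℕ.+ r → F r * F ℓ ≈ ε * u → F m * F ℓ ≈ 1ℤ
  via-quotient-1 r ℓ = via-quotient 1 r ℓ (≈-reflexive [εu]^1)

  via-quotient-2 : ∀ r ℓ {m} → m ≡ 2 ℕ.* n ℕ.+ r → F r * F ℓ ≈ ε → F m * F ℓ ≈ 1ℤ
  via-quotient-2 r ℓ = via-quotient 2 r ℓ [εu]^2

  via-quotient-3 : ∀ r ℓ {m} → m ≡ 3 ℕ.* n ℕ.+ r → F r * F ℓ ≈ u → F m * F ℓ ≈ 1ℤ
  via-quotient-3 r ℓ = via-quotient 3 r ℓ [εu]^3

  ε≡1⇒u≈εu : ε ≡ 1ℤ → u ≈ ε * u
  ε≡1⇒u≈εu ε≡1 = ≈-reflexive (sym (trans (cong (_* u) ε≡1) (*-identityˡ u)))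

  ε≡-1⇒w≈εu : ε ≡ -1ℤ → w ≈ ε * u
  ε≡-1⇒w≈εu ε≡-1 = ≈-trans (≈-sym -u≈w) (≈-reflexive (sym (trans (cong (_* u) ε≡-1) (-1*i≡-i u))))

  Solution⇒inverse : ∀ {ℓ m} → Solution ℓ m → F m * F ℓ ≈ 1ℤ
  Solution⇒inverse (c1-even ε≡1 refl refl) = ≈-trans w*w≈ε (≈-reflexive ε≡1)
  Solution⇒inverse (c1-odd ε≡-1 refl refl) =
    ≈-trans (≈-trans (≈-reflexive (*-comm w u)) u*w≈-ε) (≈-reflexive (cong -_ ε≡-1))
  Solution⇒inverse (c2-even ε≡1 refl (inj₁ refl)) = ≈-trans cassini (≈-reflexive ε≡1)
  Solution⇒inverse (c2-even ε≡1 refl (inj₂ (inj₁ refl))) =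
    via-quotient-1 1 (n ∸ 1) (sym (1*n+r≡n+j refl)) (≈-trans (≈-reflexive (*-identityˡ u)) (ε≡1⇒u≈εu ε≡1))
  Solution⇒inverse (c2-even ε≡1 refl (inj₂ (inj₂ refl))) =
    via-quotient-1 2 (n ∸ 1) (sym (1*n+r≡n+j refl)) (≈-trans (≈-reflexive (*-identityˡ u)) (ε≡1⇒u≈εu ε≡1))
  Solution⇒inverse (c2-odd ε≡-1 refl (inj₁ refl)) = ≈-trans u*w≈-ε (≈-reflexive (cong -_ ε≡-1))
  Solution⇒inverse (c2-odd ε≡-1 refl (inj₂ (inj₁ refl))) =
    via-quotient-1 1 (n ∸ 2) (sym (1*n+r≡n+j refl)) (≈-trans (≈-reflexive (*-identityˡ w)) (ε≡-1⇒w≈εu ε≡-1))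
  Solution⇒inverse (c2-odd ε≡-1 refl (inj₂ (inj₂ refl))) =
    via-quotient-1 2 (n ∸ 2) (sym (1*n+r≡n+j refl)) (≈-trans (≈-reflexive (*-identityˡ w)) (ε≡-1⇒w≈εu ε≡-1))
  Solution⇒inverse (c3 ε≡-1 refl refl) =
    via-quotient-1 (n ∸ 2) 2 (sym (q*n+[n∸j]≡[1+q]*n∸j 1 (ℕ.m≤m+n 2 (2 ℕ.+ p)) refl))
      (≈-trans (≈-reflexive (*-identityʳ w)) (ε≡-1⇒w≈εu ε≡-1))
  Solution⇒inverse (c4 ε≡1 refl (inj₁ refl)) =
    via-quotient-1 (n ∸ 1) 2 (sym (q*n+[n∸j]≡[1+q]*n∸j 1 (s≤s z≤n) refl))
      (≈-trans (≈-reflexive (*-identityʳ u)) (ε≡1⇒u≈εu ε≡1))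
  Solution⇒inverse (c4 ε≡1 refl (inj₂ (inj₁ refl))) = via-quotient-2 1 2 refl (≈-reflexive (sym ε≡1))
  Solution⇒inverse (c4 ε≡1 refl (inj₂ (inj₂ refl))) = via-quotient-2 2 2 refl (≈-reflexive (sym ε≡1))
  Solution⇒inverse (c5 refl refl) =
    via-quotient-2 (n ∸ 2) (n ∸ 2) (sym (q*n+[n∸j]≡[1+q]*n∸j 2 (ℕ.m≤m+n 2 (2 ℕ.+ p)) refl)) w*w≈ε
  Solution⇒inverse (c6 refl (inj₁ refl)) =
    via-quotient-2 (n ∸ 1) (n ∸ 1) (sym (q*n+[n∸j]≡[1+q]*n∸j 2 (s≤s z≤n) refl)) cassini
  Solution⇒inverse (c6 refl (inj₂ (inj₁ refl))) = via-quotient-3 1 (n ∸ 1) refl (≈-reflexive (*-identityˡ u))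
  Solution⇒inverse (c6 refl (inj₂ (inj₂ refl))) = via-quotient-3 2 (n ∸ 1) refl (≈-reflexive (*-identityˡ u))
  Solution⇒inverse (c7 refl refl) =
    via-quotient-3 (n ∸ 1) 2 (sym (q*n+[n∸j]≡[1+q]*n∸j 3 (s≤s z≤n) refl)) (≈-reflexive (*-identityʳ u))

  Solution⇒ℓ<n : ∀ {ℓ m} → Solution ℓ m → ℓ < n
  Solution⇒ℓ<n (c1-even _ refl _) = ℕ.<-trans (ℕ.n<1+n _) (ℕ.n<1+n _)
  Solution⇒ℓ<n (c1-odd _ refl _) = ℕ.n<1+n _
  Solution⇒ℓ<n (c2-even _ refl _) = ℕ.n<1+n _
  Solution⇒ℓ<n (c2-odd _ refl _) = ℕ.<-trans (ℕ.n<1+n _) (ℕ.n<1+n _)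
  Solution⇒ℓ<n (c3 _ refl _) = s≤s (s≤s (s≤s z≤n))
  Solution⇒ℓ<n (c4 _ refl _) = s≤s (s≤s (s≤s z≤n))
  Solution⇒ℓ<n (c5 refl _) = ℕ.<-trans (ℕ.n<1+n _) (ℕ.n<1+n _)
  Solution⇒ℓ<n (c6 refl _) = ℕ.n<1+n _
  Solution⇒ℓ<n (c7 refl _) = s≤s (s≤s (s≤s z≤n))

  inverse⇔Solution : ∀ {ℓ m} → 2 ≤ ℓ → 3 ≤ m → m < 4 ℕ.* n → (ℓ < n × F m * F ℓ ≈ 1ℤ) ⇔ Solution ℓ m
  inverse⇔Solution 2≤ℓ 3≤m m<4n =
    mk⇔ (λ (ℓ<n , h) → inverse⇒Solution 2≤ℓ ℓ<n 3≤m m<4n h) (λ s → Solution⇒ℓ<n s , Solution⇒inverse s)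

  Conditions : ℕ → ℕ → Set
  Conditions ℓ m =
    (ℓ ≡ n ∸ (2 ∸ n % 2) × m ≡ n ∸ 2)
    ⊎ (ℓ ≡ n ∸ (1 ℕ.+ n % 2) × (m ≡ n ∸ 1 ⊎ m ≡ n ℕ.+ 1 ⊎ m ≡ n ℕ.+ 2))
    ⊎ (ℓ ≡ 2 × m ≡ 2 ℕ.* n ∸ 2 × n % 2 ≡ 1)
    ⊎ (ℓ ≡ 2 × (m ≡ 2 ℕ.* n ∸ 1 ⊎ m ≡ 2 ℕ.* n ℕ.+ 1 ⊎ m ≡ 2 ℕ.* n ℕ.+ 2) × n % 2 ≡ 0)
    ⊎ (ℓ ≡ n ∸ 2 × m ≡ 3 ℕ.* n ∸ 2)
    ⊎ (ℓ ≡ n ∸ 1 × (m ≡ 3 ℕ.* n ∸ 1 ⊎ m ≡ 3 ℕ.* n ℕ.+ 1 ⊎ m ≡ 3 ℕ.* n ℕ.+ 2))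
    ⊎ (ℓ ≡ 2 × m ≡ 4 ℕ.* n ∸ 1)

  Solution⇔Conditions : ∀ {ℓ m} → Solution ℓ m ⇔ Conditions ℓ m
  Solution⇔Conditions {ℓ} {m} = mk⇔ to from
    where
    to : Solution ℓ m → Conditions ℓ m
    to (c1-even ε≡1 eℓ em) = inj₁ (trans eℓ (cong (λ r → n ∸ (2 ∸ r)) (sym (ε≡1⇒even ε≡1))) , em)
    to (c1-odd ε≡-1 eℓ em) = inj₁ (trans eℓ (cong (λ r → n ∸ (2 ∸ r)) (sym (ε≡-1⇒odd ε≡-1))) , em)
    to (c2-even ε≡1 eℓ em) = inj₂ (inj₁ (trans eℓ (cong (λ r → n ∸ (1 ℕ.+ r)) (sym (ε≡1⇒even ε≡1))) , em))
    to (c2-odd ε≡-1 eℓ em) = inj₂ (inj₁ (trans eℓ (cong (λ r → n ∸ (1 ℕ.+ r)) (sym (ε≡-1⇒odd ε≡-1))) , em))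
    to (c3 ε≡-1 eℓ em) = inj₂ (inj₂ (inj₁ (eℓ , em , ε≡-1⇒odd ε≡-1)))
    to (c4 ε≡1 eℓ em) = inj₂ (inj₂ (inj₂ (inj₁ (eℓ , em , ε≡1⇒even ε≡1))))
    to (c5 eℓ em) = inj₂ (inj₂ (inj₂ (inj₂ (inj₁ (eℓ , em)))))
    to (c6 eℓ em) = inj₂ (inj₂ (inj₂ (inj₂ (inj₂ (inj₁ (eℓ , em))))))
    to (c7 eℓ em) = inj₂ (inj₂ (inj₂ (inj₂ (inj₂ (inj₂ (eℓ , em))))))
    from : Conditions ℓ m → Solution ℓ m
    from (inj₁ (eℓ , em)) with parity
    ... | inj₁ (ε≡1 , even) = c1-even ε≡1 (trans eℓ (cong (λ r → n ∸ (2 ∸ r)) even)) em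
    ... | inj₂ (ε≡-1 , odd) = c1-odd ε≡-1 (trans eℓ (cong (λ r → n ∸ (2 ∸ r)) odd)) em
    from (inj₂ (inj₁ (eℓ , em))) with parity
    ... | inj₁ (ε≡1 , even) = c2-even ε≡1 (trans eℓ (cong (λ r → n ∸ (1 ℕ.+ r)) even)) em
    ... | inj₂ (ε≡-1 , odd) = c2-odd ε≡-1 (trans eℓ (cong (λ r → n ∸ (1 ℕ.+ r)) odd)) em
    from (inj₂ (inj₂ (inj₁ (eℓ , em , odd)))) with parity
    ... | inj₁ (_ , even) = ⊥-elim (ℕ.0≢1+n (trans (sym even) odd))
    ... | inj₂ (ε≡-1 , _) = c3 ε≡-1 eℓ em
    from (inj₂ (inj₂ (inj₂ (inj₁ (eℓ , em , even))))) with parity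
    ... | inj₁ (ε≡1 , _) = c4 ε≡1 eℓ em
    ... | inj₂ (_ , odd) = ⊥-elim (ℕ.0≢1+n (trans (sym even) odd))
    from (inj₂ (inj₂ (inj₂ (inj₂ (inj₁ (eℓ , em)))))) = c5 eℓ em
    from (inj₂ (inj₂ (inj₂ (inj₂ (inj₂ (inj₁ (eℓ , em))))))) = c6 eℓ em
    from (inj₂ (inj₂ (inj₂ (inj₂ (inj₂ (inj₂ (eℓ , em))))))) = c7 eℓ em

open import Data.Nat using (suc; _+_; _*_; _∸_; _<_; _≤_; _%_; NonZero; s≤s; z≤n)
open import Data.Product using (_×_)
open import Data.Product.Function.NonDependent.Propositional using (_×-⇔_)
open import Data.Sum using (_⊎_)
open import Relation.Binary.PropositionalEquality using (_≡_)
open import Function.Bundles using (_⇔_)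
import Function.Properties.Equivalence as ⇔

theorem1 : (ℓ m n : ℕ) → 2 ≤ ℓ → 3 ≤ m → 4 ≤ n → m < 4 * n →
    (nz : NonZero (fib n)) →
    InvModIs (fib m) (fib n) {{nz}} (fib ℓ) ⇔
      ((ℓ ≡ n ∸ (2 ∸ n % 2) × m ≡ n ∸ 2)
      ⊎ (ℓ ≡ n ∸ (1 + n % 2) × (m ≡ n ∸ 1 ⊎ m ≡ n + 1 ⊎ m ≡ n + 2))
      ⊎ (ℓ ≡ 2 × m ≡ 2 * n ∸ 2 × n % 2 ≡ 1)
      ⊎ (ℓ ≡ 2 × (m ≡ 2 * n ∸ 1 ⊎ m ≡ 2 * n + 1 ⊎ m ≡ 2 * n + 2) × n % 2 ≡ 0)
      ⊎ (ℓ ≡ n ∸ 2 × m ≡ 3 * n ∸ 2)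
      ⊎ (ℓ ≡ n ∸ 1 × (m ≡ 3 * n ∸ 1 ⊎ m ≡ 3 * n + 1 ⊎ m ≡ 3 * n + 2))
      ⊎ (ℓ ≡ 2 × m ≡ 4 * n ∸ 1))
theorem1 ℓ m (suc (suc (suc (suc p)))) 2≤ℓ 3≤m (s≤s (s≤s (s≤s (s≤s z≤n)))) m<4n nz =
  ⇔.trans (InvModIs⇔ (fib m) (fib ℓ) {{nz}} 1<N)
    (⇔.trans (FibonacciNat.fib-mono-<-⇔ 2≤ℓ ×-⇔ ⇔.refl)
      (⇔.trans (inverse⇔Solution 2≤ℓ 3≤m m<4n) Solution⇔Conditions))
  where
  open Classification p
  open Inverses p
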